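{- Let $m\geq 0$ and $k\geq 2$ be integers, let $U_m=\{2p+1 : 0\leq p\leq m\}$, and let $v_0$ be a vertex of the circulant graph $C_{(2m+3)k}(U_m)$. Let $\phi_{v_0}$ be the edge-coloring of $C_{(2m+3)k}(U_m)$ with colors in $\{0\}\cup\{l_i : 0\le i\le m\}\cup\{r_i: 0\le i\le m\}$ determined by the rules: (i) $\phi_{v_0}(v_0,v_0+1)=0$; (ii) for $i\in\{0,\dots,m\}$, $\phi_{v_0}(v_0+1+i,v_0+2+i)=r_i$ and $\phi_{v_0}(v_0-i-1,v_0-i)=l_i$; (iii) for every vertex $v$, $\phi_{v_0}(v+2m+3,v+2m+4)=\phi_{v_0}(v,v+1)$; (iv) for every vertex $v$ and every $p\in\{0,\dots,m\}$, $\phi_{v_0}(v-p,v+1+p)=\phi_{v_0}(v,v+1)$. Then $\phi_{v_0}$ is a proper edge-coloring of $C_{(2m+3)k}(U_m)$ using $2m+3$ colors, and for any two vertices $i,j$ with $|i-j|\in\{1,2,\dots,2m+2\}$, the set of colors of edges incident to $i$ differs from the set of colors of edges incident to $j$.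
   Context: For $n\in\mathbb{N}^*$ and $S\subset\mathbb{Z}_n$, the circulant graph $C_n(S)$ is the simple undirected graph with vertex set $\mathbb{Z}_n$ in which $i$ and $j$ are adjacent if and only if $i-j\equiv \pm s\pmod n$ for some $s\in S$; vertex arithmetic is modulo $n$, and $|i-j|$ denotes the distance between $i$ and $j$ in $\mathbb{Z}_n$ (i.e. the smallest nonnegative $d$ with $i-j\equiv\pm d$). A proper edge-coloring assigns colors to edges so that edges sharing an endpoint get different colors. -}

module Defs where

open import Data.Nat using (ℕ; zero; suc; _+_; _*_; _≤_; _⊓_)
open import Data.Integer as ℤ using (ℤ; +_; -[1+_]; _-_)
open import Data.Integer.DivMod using (_%ℕ_; n%ℕd<d)
open import Data.Fin using (Fin; toℕ; fromℕ<)
open import Data.Product using (Σ; _×_; ∃-syntax)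
open import Data.Sum using (_⊎_)
open import Relation.Binary.PropositionalEquality using (_≡_)

-- residue of an integer modulo n, as a natural number in [0, n) (0 if n = 0)
reduce : ℕ → ℤ → ℕ
reduce zero    _ = 0
reduce (suc n) z = z %ℕ suc n

infixl 6 _⊕_
_⊕_ : ∀ {n} → Fin n → ℤ → Fin n
_⊕_ {suc n} v d = fromℕ< (n%ℕd<d (+ toℕ v ℤ.+ d) (suc n))

dist : ∀ {n} → Fin n → Fin n → ℕ
dist {n} i j = reduce n (+ toℕ i - + toℕ j) ⊓ reduce n (+ toℕ j - + toℕ i)

CircAdj : ∀ {n} → (ℕ → Set) → Fin n → Fin n → Set
CircAdj S i j = ∃[ s ] (S s × ((j ≡ i ⊕ + s) ⊎ (i ≡ j ⊕ + s)))

U : ℕ → ℕ → Set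
U m s = ∃[ p ] (p ≤ m × s ≡ 2 * p + 1)

data Colour (m : ℕ) : Set where
  c0 : Colour m
  l  : Fin (suc m) → Colour m
  r  : Fin (suc m) → Colour m

module Submission where

-- Write M = 2m + 3 and number the colours by residues modulo M: c0 ↦ 0, r i ↦ 1 + i and
-- l i ↦ -1 - i.  Rules (i) and (ii) colour the unit edges {v₀ + t, v₀ + t + 1} for t in a full
-- window of residues, and rule (iii) propagates this periodically, so every unit edge
-- {a, a + 1} gets the colour numbered a - v₀.  Rule (iv), applied at the midpoint a + p, then
-- gives the edge {a, a + 2p + 1} the number a - v₀ + p, and by symmetry of φ the edge
-- {a, a - 2p - 1} gets a - v₀ - 1 - p.  Hence the colours at a are numbered a - v₀ + x for the
-- 2m + 2 offsets x ∈ [-m - 1, m]; these are pairwise incongruent modulo M and miss exactly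
-- the residue a - v₀ + m + 1.  Properness follows, every colour occurs on a unit edge, and two
-- vertices with equal colour sets miss the same colour, so they are congruent modulo M, which
-- (as M divides N) is impossible at cyclic distance 1, …, 2m + 2.

open import Defs
open import Data.Nat using (ℕ; zero; suc; _+_; _*_; _≤_; _<_; _∸_; _⊓_; z≤n; s≤s; NonZero)
import Data.Nat.Properties as ℕ
import Data.Nat.Divisibility as ℕ∣
import Data.Nat.Tactic.RingSolver as ℕ-Solver
open import Data.Integer using (ℤ; +_; -[1+_]; -_; ∣_∣)
  renaming (_+_ to _+ᶻ_; _-_ to _-ᶻ_; _*_ to _*ᶻ_)
import Data.Integer.Properties as ℤ
open import Data.Integer.Divisibility.Signed
  using (_∣_; divides; ∣⇒∣ᵤ; ∣ᵤ⇒∣; ∣-trans; ∣m∣n⇒∣m+n; ∣m⇒∣-m)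
open import Data.Integer.DivMod using (_%ℕ_; _/ℕ_; n%ℕd<d; a≡a%ℕn+[a/ℕn]*n)
open import Data.Integer.Tactic.RingSolver using (solve-∀)
open import Algebra.Properties.AbelianGroup ℤ.+-0-abelianGroup using (∙-cancelʳ)
open import Data.Fin using (Fin; toℕ; fromℕ<; splitAt; _↑ˡ_; _↑ʳ_; opposite)
open import Data.Fin.Properties
  using ( toℕ-fromℕ<; toℕ-injective; toℕ<n; fromℕ<-cong; toℕ-↑ˡ; toℕ-↑ʳ
        ; splitAt⁻¹-↑ˡ; splitAt⁻¹-↑ʳ; opposite-prop; opposite-involutive)
open import Data.Product using (Σ; _×_; _,_; ∃-syntax)
open import Data.Sum using (_⊎_; inj₁; inj₂; [_,_]′)
open import Data.Empty using (⊥-elim)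
open import Function using (_∘_)
open import Function.Bundles using (_⇔_; Equivalence)
open import Level using (0ℓ)
open import Relation.Nullary using (¬_; yes; no)
open import Relation.Binary.Bundles using (Setoid)
import Relation.Binary.Reasoning.Setoid as SetoidReasoning
open import Relation.Binary.PropositionalEquality
  using (_≡_; _≢_; refl; sym; trans; cong; cong₂; subst; subst₂; module ≡-Reasoning)

infix 4 _≡_mod_
record _≡_mod_ (x y : ℤ) (n : ℕ) : Set where
  constructor congruent
  field divides-difference : + n ∣ x -ᶻ y
open _≡_mod_

module _ {n : ℕ} where

  ≡-by : ∀ {x y x' y'} → x -ᶻ y ≡ x' -ᶻ y' → x ≡ y mod n → x' ≡ y' mod n
  ≡-by e (congruent c) = congruent (subst (+ n ∣_) e c)

  ≡-reflexive : ∀ {x y} → x ≡ y → x ≡ y mod n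
  ≡-reflexive {x} refl = congruent (divides (+ 0) (ℤ.+-inverseʳ x))

  ≡-refl : ∀ {x} → x ≡ x mod n
  ≡-refl {x} = ≡-reflexive {x} refl

  ≡-sym : ∀ {x y} → x ≡ y mod n → y ≡ x mod n
  ≡-sym {x} {y} (congruent c) = congruent (subst (+ n ∣_) (lemma x y) (∣m⇒∣-m c))
    where
    lemma : ∀ x y → - (x -ᶻ y) ≡ y -ᶻ x
    lemma = solve-∀

  ≡-trans : ∀ {x y z} → x ≡ y mod n → y ≡ z mod n → x ≡ z mod n
  ≡-trans {x} {y} {z} (congruent c) (congruent d) = congruent (subst (+ n ∣_) (lemma x y z) (∣m∣n⇒∣m+n c d))
    where
    lemma : ∀ x y z → (x -ᶻ y) +ᶻ (y -ᶻ z) ≡ x -ᶻ z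
    lemma = solve-∀

  +-cong : ∀ {x y x' y'} → x ≡ y mod n → x' ≡ y' mod n → x +ᶻ x' ≡ y +ᶻ y' mod n
  +-cong {x} {y} {x'} {y'} (congruent c) (congruent d) =
    congruent (subst (+ n ∣_) (lemma x y x' y') (∣m∣n⇒∣m+n c d))
    where
    lemma : ∀ x y x' y' → (x -ᶻ y) +ᶻ (x' -ᶻ y') ≡ (x +ᶻ x') -ᶻ (y +ᶻ y')
    lemma = solve-∀

  +-cancelˡ : ∀ {k x y} → k +ᶻ x ≡ k +ᶻ y mod n → x ≡ y mod n
  +-cancelˡ {k} {x} {y} = ≡-by (lemma k x y)
    where
    lemma : ∀ k x y → (k +ᶻ x) -ᶻ (k +ᶻ y) ≡ x -ᶻ y
    lemma = solve-∀

  +-cancelʳ : ∀ {k x y} → x +ᶻ k ≡ y +ᶻ k mod n → x ≡ y mod n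
  +-cancelʳ {k} {x} {y} = ≡-by (lemma k x y)
    where
    lemma : ∀ k x y → (x +ᶻ k) -ᶻ (y +ᶻ k) ≡ x -ᶻ y
    lemma = solve-∀

  residue : .{{_ : NonZero n}} → ∀ x → + (x %ℕ n) ≡ x mod n
  residue x = congruent (divides (- (x /ℕ n)) (begin
      + (x %ℕ n) -ᶻ x                                  ≡⟨ cong (+ (x %ℕ n) -ᶻ_) (a≡a%ℕn+[a/ℕn]*n x n) ⟩
      + (x %ℕ n) -ᶻ (+ (x %ℕ n) +ᶻ (x /ℕ n) *ᶻ + n)    ≡⟨ lemma (+ (x %ℕ n)) (x /ℕ n) (+ n) ⟩
      - (x /ℕ n) *ᶻ + n                                ∎))
    where
    open ≡-Reasoning
    lemma : ∀ r q d → r -ᶻ (r +ᶻ q *ᶻ d) ≡ - q *ᶻ d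
    lemma = solve-∀

  residue-unique : ∀ {a b} → a < n → b < n → + a ≡ + b mod n → a ≡ b
  residue-unique {a} {b} a<n b<n c with ∣ + a -ᶻ + b ∣ in d≡
  ... | zero  = ℤ.+-injective (ℤ.i-j≡0⇒i≡j (+ a) (+ b) (ℤ.∣i∣≡0⇒i≡0 d≡))
  ... | suc d = ⊥-elim (ℕ∣.>⇒∤ d<n (subst (n ℕ∣.∣_) d≡ (∣⇒∣ᵤ (divides-difference c))))
    where
    d<n : suc d < n
    d<n = subst (_< n) (trans (cong ∣_∣ (sym (ℤ.m-n≡m⊖n a b))) d≡)
            (ℕ.≤-<-trans (ℤ.∣m⊝n∣≤m⊔n a b) (ℕ.⊔-lub a<n b<n))

  zero-residue⇒∣ : ∀ {t} → + t ≡ + 0 mod n → n ℕ∣.∣ t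
  zero-residue⇒∣ {t} c = subst (n ℕ∣.∣_) (ℕ.+-identityʳ t) (∣⇒∣ᵤ (divides-difference c))

  mod-divisor : ∀ {d x y} → d ℕ∣.∣ n → x ≡ y mod n → x ≡ y mod d
  mod-divisor d∣n (congruent c) = congruent (∣-trans (∣ᵤ⇒∣ d∣n) c)

≡-mod-setoid : ℕ → Setoid 0ℓ 0ℓ
≡-mod-setoid n = record
  { Carrier       = ℤ
  ; _≈_           = _≡_mod n
  ; isEquivalence = record { refl = ≡-refl ; sym = ≡-sym ; trans = ≡-trans }
  }

module ≡-mod-Reasoning (n : ℕ) = SetoidReasoning (≡-mod-setoid n)

⟦_⟧ : ∀ {n} → Fin n → ℤ
⟦ v ⟧ = + toℕ v

module _ {n : ℕ} where

  ⊕-spec : ∀ (v : Fin (suc n)) d → ⟦ v ⊕ d ⟧ ≡ ⟦ v ⟧ +ᶻ d mod suc n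
  ⊕-spec v d = subst (λ t → + t ≡ ⟦ v ⟧ +ᶻ d mod suc n) (sym (toℕ-fromℕ< _)) (residue (⟦ v ⟧ +ᶻ d))

  ⟦⟧-injective : ∀ {a b : Fin (suc n)} → ⟦ a ⟧ ≡ ⟦ b ⟧ mod suc n → a ≡ b
  ⟦⟧-injective {a} {b} c = toℕ-injective (residue-unique (toℕ<n a) (toℕ<n b) c)

  ⊕-identity : ∀ (v : Fin (suc n)) → v ⊕ + 0 ≡ v
  ⊕-identity v = ⟦⟧-injective (≡-trans (⊕-spec v (+ 0)) (≡-reflexive (ℤ.+-identityʳ ⟦ v ⟧)))

  ⊕-assoc : ∀ (v : Fin (suc n)) d e → (v ⊕ d) ⊕ e ≡ v ⊕ (d +ᶻ e)
  ⊕-assoc v d e = ⟦⟧-injective (begin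
      ⟦ (v ⊕ d) ⊕ e ⟧     ≈⟨ ⊕-spec (v ⊕ d) e ⟩
      ⟦ v ⊕ d ⟧ +ᶻ e      ≈⟨ +-cong (⊕-spec v d) ≡-refl ⟩
      ⟦ v ⟧ +ᶻ d +ᶻ e     ≡⟨ ℤ.+-assoc ⟦ v ⟧ d e ⟩
      ⟦ v ⟧ +ᶻ (d +ᶻ e)   ≈⟨ ⊕-spec v (d +ᶻ e) ⟨
      ⟦ v ⊕ (d +ᶻ e) ⟧    ∎)
    where open ≡-mod-Reasoning (suc n)

  ⊕-suc : ∀ (v : Fin (suc n)) t → (v ⊕ + t) ⊕ + 1 ≡ v ⊕ + suc t
  ⊕-suc v t = trans (⊕-assoc v (+ t) (+ 1))
                    (cong (v ⊕_) (trans (sym (ℤ.pos-+ t 1)) (cong +_ (ℕ.+-comm t 1))))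

  ⊕-cancel : ∀ (v : Fin (suc n)) d → (v ⊕ d) ⊕ (- d) ≡ v
  ⊕-cancel v d = trans (⊕-assoc v d (- d)) (trans (cong (v ⊕_) (ℤ.+-inverseʳ d)) (⊕-identity v))

  ⊕-cancel′ : ∀ (v : Fin (suc n)) d → (v ⊕ (- d)) ⊕ d ≡ v
  ⊕-cancel′ v d = trans (⊕-assoc v (- d) d) (trans (cong (v ⊕_) (ℤ.+-inverseˡ d)) (⊕-identity v))

  ⊕-difference : ∀ (a b : Fin (suc n)) → a ⊕ + ((⟦ b ⟧ -ᶻ ⟦ a ⟧) %ℕ suc n) ≡ b
  ⊕-difference a b = ⟦⟧-injective (begin
      ⟦ a ⊕ + ((⟦ b ⟧ -ᶻ ⟦ a ⟧) %ℕ suc n) ⟧    ≈⟨ ⊕-spec a (+ ((⟦ b ⟧ -ᶻ ⟦ a ⟧) %ℕ suc n)) ⟩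
      ⟦ a ⟧ +ᶻ + ((⟦ b ⟧ -ᶻ ⟦ a ⟧) %ℕ suc n)   ≈⟨ +-cong (≡-refl {x = ⟦ a ⟧}) (residue (⟦ b ⟧ -ᶻ ⟦ a ⟧)) ⟩
      ⟦ a ⟧ +ᶻ (⟦ b ⟧ -ᶻ ⟦ a ⟧)                 ≡⟨ lemma ⟦ a ⟧ ⟦ b ⟧ ⟩
      ⟦ b ⟧                                    ∎)
    where
    open ≡-mod-Reasoning (suc n)
    lemma : ∀ x y → x +ᶻ (y -ᶻ x) ≡ y
    lemma = solve-∀

  small-multiple : ∀ {M} z → M ℕ∣.∣ suc n → z ≡ + 0 mod M → z %ℕ suc n < M → z %ℕ suc n ≡ 0
  small-multiple z M∣N z≡0 r<M =
    residue-unique r<M (ℕ.≤-<-trans z≤n r<M) (≡-trans (mod-divisor M∣N (residue z)) z≡0)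

  near-incongruent : ∀ {M} → M ℕ∣.∣ suc n → (i j : Fin (suc n)) →
                     1 ≤ dist i j → dist i j < M → ¬ ⟦ i ⟧ ≡ ⟦ j ⟧ mod M
  near-incongruent {M} M∣N i j 1≤d d<M i≡j = ℕ.<⇒≢ 1≤d (sym (dist≡0 (ℕ.⊓-sel d₁ d₂)))
    where
    d₁ d₂ : ℕ
    d₁ = (⟦ i ⟧ -ᶻ ⟦ j ⟧) %ℕ suc n
    d₂ = (⟦ j ⟧ -ᶻ ⟦ i ⟧) %ℕ suc n
    multiple : ∀ {x y} → x ≡ y mod M → x -ᶻ y ≡ + 0 mod M
    multiple = ≡-by (sym (ℤ.+-identityʳ _))
    dist≡0 : d₁ ⊓ d₂ ≡ d₁ ⊎ d₁ ⊓ d₂ ≡ d₂ → dist i j ≡ 0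
    dist≡0 (inj₁ e) = trans e (small-multiple _ M∣N (multiple i≡j) (subst (_< M) e d<M))
    dist≡0 (inj₂ e) = trans e (small-multiple _ M∣N (multiple (≡-sym i≡j)) (subst (_< M) e d<M))

-- The number of colours, M = 2m + 3, written so that Fin M splits as {0} ⊎ Fin (m+1) ⊎ Fin (m+1).
period : ℕ → ℕ
period m = suc (suc m + suc m)

period≡ : ∀ m → 2 * m + 3 ≡ period m
period≡ = lemma
  where
  lemma : ∀ m → 2 * m + 3 ≡ suc (suc m + suc m)
  lemma = ℕ-Solver.solve-∀

module _ {m : ℕ} where

  -- Colours are numbered by residues modulo M: c0 ↦ 0, r i ↦ 1 + i, l i ↦ 2m + 2 - i ≡ -1 - i.
  colour : Fin (period m) → Colour m
  colour Fin.zero    = c0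
  colour (Fin.suc j) = [ r , l ∘ opposite ]′ (splitAt (suc m) j)

  position : Colour m → Fin (period m)
  position c0    = Fin.zero
  position (r i) = Fin.suc (i ↑ˡ suc m)
  position (l i) = Fin.suc (suc m ↑ʳ opposite i)

  position-colour : ∀ j → position (colour j) ≡ j
  position-colour Fin.zero    = refl
  position-colour (Fin.suc j) with splitAt (suc m) j in eq
  ... | inj₁ i = cong Fin.suc (splitAt⁻¹-↑ˡ eq)
  ... | inj₂ i = cong Fin.suc (trans (cong (suc m ↑ʳ_) (opposite-involutive i)) (splitAt⁻¹-↑ʳ eq))

  position-r : ∀ i → toℕ (position (r i)) ≡ suc (toℕ i)
  position-r i = cong suc (toℕ-↑ˡ i (suc m))

  -- l i is numbered -1 - i modulo M.
  position-l : ∀ i → toℕ (position (l i)) + suc (toℕ i) ≡ period m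
  position-l i = begin
      suc (toℕ (suc m ↑ʳ opposite i)) + suc (toℕ i)   ≡⟨ cong (λ t → suc t + suc (toℕ i)) (toℕ-↑ʳ (suc m) (opposite i)) ⟩
      suc (suc m + toℕ (opposite i) + suc (toℕ i))     ≡⟨ cong suc (ℕ.+-assoc (suc m) (toℕ (opposite i)) (suc (toℕ i))) ⟩
      suc (suc m + (toℕ (opposite i) + suc (toℕ i)))   ≡⟨ cong (λ t → suc (suc m + t)) opposite+i≡m+1 ⟩
      period m                                         ∎
    where
    open ≡-Reasoning
    opposite+i≡m+1 : toℕ (opposite i) + suc (toℕ i) ≡ suc m
    opposite+i≡m+1 = begin
      toℕ (opposite i) + suc (toℕ i)   ≡⟨ cong (_+ suc (toℕ i)) (opposite-prop i) ⟩
      (m ∸ toℕ i) + suc (toℕ i)        ≡⟨ ℕ.+-suc (m ∸ toℕ i) (toℕ i) ⟩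
      suc (m ∸ toℕ i + toℕ i)          ≡⟨ cong suc (ℕ.m∸n+n≡m (ℕ.≤-pred (toℕ<n i))) ⟩
      suc m                            ∎

  colourOf : ℤ → Colour m
  colourOf x = colour (fromℕ< (n%ℕd<d x (period m)))

  position-colourOf : ∀ x → + toℕ (position (colourOf x)) ≡ x mod period m
  position-colourOf x =
    subst (λ t → + t ≡ x mod period m)
          (sym (trans (cong toℕ (position-colour _)) (toℕ-fromℕ< _)))
          (residue x)

  colourOf-cong : ∀ {x y} → x ≡ y mod period m → colourOf x ≡ colourOf y
  colourOf-cong {x} {y} x≡y = cong colour (fromℕ<-cong _ _ same-residue _ _)
    where
    open ≡-mod-Reasoning (period m)
    same-residue : x %ℕ period m ≡ y %ℕ period m
    same-residue = residue-unique (n%ℕd<d x (period m)) (n%ℕd<d y (period m)) (begin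
      + (x %ℕ period m)  ≈⟨ residue x ⟩
      x                  ≈⟨ x≡y ⟩
      y                  ≈⟨ residue y ⟨
      + (y %ℕ period m)  ∎)

  colourOf-injective : ∀ {x y} → colourOf x ≡ colourOf y → x ≡ y mod period m
  colourOf-injective {x} {y} e = begin
      x                                    ≈⟨ position-colourOf x ⟨
      + toℕ (position (colourOf x))        ≡⟨ cong (λ c → + toℕ (position c)) e ⟩
      + toℕ (position (colourOf y))        ≈⟨ position-colourOf y ⟩
      y                                    ∎
    where open ≡-mod-Reasoning (period m)

-- The offsets of the 2m + 2 edges at a vertex: the edge of length 2p + 1 leaving forwards
-- has offset p, the one leaving backwards has offset -1 - p.
data Offset (m : ℕ) : ℤ → Set where
  fwd : ∀ {p} → p ≤ m → Offset m (+ p)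
  bwd : ∀ {p} → p ≤ m → Offset m -[1+ p ]

module _ {m : ℕ} where

  -- Offsets fill the window [-m-1, m]; the slot of an offset is its place in that window.
  slot : ∀ {x} → Offset m x → ℕ
  slot (fwd {p} _) = suc m + p
  slot (bwd {p} _) = m ∸ p

  slot-spec : ∀ {x} (o : Offset m x) → x +ᶻ + suc m ≡ + slot o
  slot-spec (fwd {p} _)  = trans (ℤ.+-comm (+ p) (+ suc m)) (sym (ℤ.pos-+ (suc m) p))
  slot-spec (bwd {p} p≤m) = trans (ℤ.[1+m]⊖[1+n]≡m⊖n m p) (ℤ.⊖-≥ p≤m)

  slot< : ∀ {x} (o : Offset m x) → slot o < suc m + suc m
  slot< (fwd p≤m)     = ℕ.+-monoʳ-< (suc m) (s≤s p≤m)
  slot< (bwd {p} p≤m) = s≤s (ℕ.≤-trans (ℕ.m∸n≤m m p) (ℕ.m≤m+n m (suc m)))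

  slot-surjective : ∀ {u} → u < suc m + suc m → Σ ℤ λ x → Σ (Offset m x) λ o → slot o ≡ u
  slot-surjective {u} u<2m+2 with u ℕ.<? suc m
  ... | yes u<m+1 = -[1+ m ∸ u ] , bwd (ℕ.m∸n≤m m u) , ℕ.m∸[m∸n]≡n (ℕ.≤-pred u<m+1)
  ... | no  u≮m+1 = + (u ∸ suc m) , fwd p≤m , m+1+p≡u
    where
    m+1+p≡u : suc m + (u ∸ suc m) ≡ u
    m+1+p≡u = ℕ.m+[n∸m]≡n (ℕ.≮⇒≥ u≮m+1)
    p≤m : u ∸ suc m ≤ m
    p≤m = ℕ.≤-pred (ℕ.+-cancelˡ-< (suc m) _ _ (subst (_< suc m + suc m) (sym m+1+p≡u) u<2m+2))

  offset-unique : ∀ {x y} → Offset m x → Offset m y → x ≡ y mod period m → x ≡ y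
  offset-unique {x} {y} o o′ x≡y = ∙-cancelʳ (+ suc m) x y (begin
      x +ᶻ + suc m     ≡⟨ slot-spec o ⟩
      + slot o         ≡⟨ cong +_ same-slot ⟩
      + slot o′        ≡⟨ slot-spec o′ ⟨
      y +ᶻ + suc m     ∎)
    where
    open ≡-Reasoning
    same-slot : slot o ≡ slot o′
    same-slot = residue-unique (ℕ.m<n⇒m<1+n (slot< o)) (ℕ.m<n⇒m<1+n (slot< o′))
      (subst₂ (_≡_mod period m) (slot-spec o) (slot-spec o′) (+-cong x≡y ≡-refl))

  offset-misses : ∀ {x} → Offset m x → ¬ x ≡ + suc m mod period m
  offset-misses {x} o x≡m+1 = ℕ.<-irrefl (residue-unique (ℕ.m<n⇒m<1+n (slot< o)) ℕ.≤-refl (begin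
      + slot o               ≡⟨ slot-spec o ⟨
      x +ᶻ + suc m           ≈⟨ +-cong x≡m+1 ≡-refl ⟩
      + suc m +ᶻ + suc m     ≡⟨ ℤ.pos-+ (suc m) (suc m) ⟨
      + (suc m + suc m)      ∎)) (slot< o)
    where open ≡-mod-Reasoning (period m)

  offset-covers : ∀ z → z ≡ + suc m mod period m ⊎ Σ ℤ λ x → Offset m x × x ≡ z mod period m
  offset-covers z with ℕ.m<1+n⇒m<n∨m≡n (n%ℕd<d (z +ᶻ + suc m) (period m))
  ... | inj₂ u≡2m+2 = inj₁ (+-cancelʳ (begin
      z +ᶻ + suc m                       ≈⟨ residue (z +ᶻ + suc m) ⟨
      + ((z +ᶻ + suc m) %ℕ period m)     ≡⟨ cong +_ u≡2m+2 ⟩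
      + (suc m + suc m)                  ≡⟨ ℤ.pos-+ (suc m) (suc m) ⟩
      + suc m +ᶻ + suc m                 ∎))
    where open ≡-mod-Reasoning (period m)
  ... | inj₁ u<2m+2 with slot-surjective u<2m+2
  ...   | x , o , slot≡u = inj₂ (x , o , +-cancelʳ (begin
      x +ᶻ + suc m                       ≡⟨ slot-spec o ⟩
      + slot o                           ≡⟨ cong +_ slot≡u ⟩
      + ((z +ᶻ + suc m) %ℕ period m)     ≈⟨ residue (z +ᶻ + suc m) ⟩
      z +ᶻ + suc m                       ∎))
    where open ≡-mod-Reasoning (period m)

module Colouring
  {m n : ℕ} (M∣N : period m ℕ∣.∣ suc n)
  (v₀ : Fin (suc n)) (φ : Fin (suc n) → Fin (suc n) → Colour m)
  (symmetric : ∀ a b → CircAdj (U m) a b → φ a b ≡ φ b a)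
  (rule-i    : φ v₀ (v₀ ⊕ + 1) ≡ c0)
  (rule-ii-r : ∀ (i : Fin (suc m)) → φ (v₀ ⊕ + (1 + toℕ i)) (v₀ ⊕ + (2 + toℕ i)) ≡ r i)
  (rule-ii-l : ∀ (i : Fin (suc m)) → φ (v₀ ⊕ -[1+ toℕ i ]) (v₀ ⊕ - (+ toℕ i)) ≡ l i)
  (rule-iii  : ∀ v → φ (v ⊕ + (2 * m + 3)) (v ⊕ + (2 * m + 4)) ≡ φ v (v ⊕ + 1))
  (rule-iv   : ∀ v p → p ≤ m → φ (v ⊕ - (+ p)) (v ⊕ + (1 + p)) ≡ φ v (v ⊕ + 1))
  where

  private
    M : ℕ
    M = period m

    Adj : Fin (suc n) → Fin (suc n) → Set
    Adj = CircAdj (U m)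

    mod-M : ∀ {x y} → x ≡ y mod suc n → x ≡ y mod M
    mod-M = mod-divisor M∣N

  unitColour : Fin (suc n) → Colour m
  unitColour a = φ a (a ⊕ + 1)

  unit-shift : ∀ a → unitColour (a ⊕ + M) ≡ unitColour a
  unit-shift a = trans (cong₂ φ (cong (λ t → a ⊕ + t) (sym (period≡ m)))
                                (trans (⊕-suc a M) (cong (λ t → a ⊕ + t) (sym (2m+4≡ m)))))
                       (rule-iii a)
    where
    2m+4≡ : ∀ m → 2 * m + 4 ≡ suc (suc (suc m + suc m))
    2m+4≡ = ℕ-Solver.solve-∀

  unit-periodic : ∀ a q → unitColour (a ⊕ + (q * M)) ≡ unitColour a
  unit-periodic a zero    = cong unitColour (⊕-identity a)
  unit-periodic a (suc q) = begin
      unitColour (a ⊕ + (M + q * M))      ≡⟨ cong unitColour (sym split) ⟩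
      unitColour ((a ⊕ + (q * M)) ⊕ + M)  ≡⟨ unit-shift (a ⊕ + (q * M)) ⟩
      unitColour (a ⊕ + (q * M))          ≡⟨ unit-periodic a q ⟩
      unitColour a                        ∎
    where
    open ≡-Reasoning
    split : (a ⊕ + (q * M)) ⊕ + M ≡ a ⊕ + (M + q * M)
    split = trans (⊕-assoc a (+ (q * M)) (+ M))
                  (cong (a ⊕_) (trans (sym (ℤ.pos-+ (q * M) M)) (cong +_ (ℕ.+-comm (q * M) M))))

  unit-congruent : ∀ {a b} → ⟦ a ⟧ ≡ ⟦ b ⟧ mod M → unitColour a ≡ unitColour b
  unit-congruent {a} {b} a≡b = from-multiple (zero-residue⇒∣ t≡0)
    where
    t : ℕ
    t = (⟦ b ⟧ -ᶻ ⟦ a ⟧) %ℕ suc n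
    t≡0 : + t ≡ + 0 mod M
    t≡0 = begin
      + t               ≈⟨ mod-M (residue (⟦ b ⟧ -ᶻ ⟦ a ⟧)) ⟩
      ⟦ b ⟧ -ᶻ ⟦ a ⟧     ≈⟨ +-cong (≡-sym a≡b) (≡-refl {x = - ⟦ a ⟧}) ⟩
      ⟦ a ⟧ -ᶻ ⟦ a ⟧     ≡⟨ ℤ.+-inverseʳ ⟦ a ⟧ ⟩
      + 0               ∎
      where open ≡-mod-Reasoning M
    from-multiple : M ℕ∣.∣ t → unitColour a ≡ unitColour b
    from-multiple (ℕ∣.divides q t≡qM) = begin
      unitColour a                 ≡⟨ unit-periodic a q ⟨
      unitColour (a ⊕ + (q * M))   ≡⟨ cong (λ s → unitColour (a ⊕ + s)) t≡qM ⟨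
      unitColour (a ⊕ + t)         ≡⟨ cong unitColour (⊕-difference a b) ⟩
      unitColour b                 ∎
      where open ≡-Reasoning

  -- Rules (i) and (ii), extended by rule (iii) for the l-colours: the unit edge at
  -- v₀ + (number of c) has colour c.
  unit-base : ∀ c → unitColour (v₀ ⊕ + toℕ (position c)) ≡ c
  unit-base c0    = trans (cong unitColour (⊕-identity v₀)) rule-i
  unit-base (r i) = begin
      unitColour (v₀ ⊕ + toℕ (position (r i)))                ≡⟨ cong (λ t → unitColour (v₀ ⊕ + t)) (position-r i) ⟩
      φ (v₀ ⊕ + (1 + toℕ i)) ((v₀ ⊕ + (1 + toℕ i)) ⊕ + 1)     ≡⟨ cong (φ _) (⊕-suc v₀ (1 + toℕ i)) ⟩
      φ (v₀ ⊕ + (1 + toℕ i)) (v₀ ⊕ + (2 + toℕ i))             ≡⟨ rule-ii-r i ⟩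
      r i                                                     ∎
    where open ≡-Reasoning
  unit-base (l i) = begin
      unitColour (v₀ ⊕ + toℕ (position (l i)))   ≡⟨ cong unitColour (sym (trans (⊕-assoc v₀ -[1+ toℕ i ] (+ M)) (cong (v₀ ⊕_) wrap))) ⟩
      unitColour (w ⊕ + M)                       ≡⟨ unit-shift w ⟩
      φ w (w ⊕ + 1)                              ≡⟨ cong (φ w) (trans (⊕-assoc v₀ -[1+ toℕ i ] (+ 1)) (cong (v₀ ⊕_) step)) ⟩
      φ w (v₀ ⊕ - (+ toℕ i))                     ≡⟨ rule-ii-l i ⟩
      l i                                        ∎
    where
    open ≡-Reasoning
    w : Fin (suc n)
    w = v₀ ⊕ -[1+ toℕ i ]
    step : -[1+ toℕ i ] +ᶻ + 1 ≡ - (+ toℕ i)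
    step = trans (ℤ.[1+m]⊖[1+n]≡m⊖n 0 (toℕ i)) (ℤ.⊖-≤ z≤n)
    wrap : -[1+ toℕ i ] +ᶻ + M ≡ + toℕ (position (l i))
    wrap = begin
      -[1+ toℕ i ] +ᶻ + M                                          ≡⟨ cong (-[1+ toℕ i ] +ᶻ_) (cong +_ (sym (position-l i))) ⟩
      -[1+ toℕ i ] +ᶻ + (toℕ (position (l i)) + suc (toℕ i))      ≡⟨ cong (-[1+ toℕ i ] +ᶻ_) (ℤ.pos-+ (toℕ (position (l i))) (suc (toℕ i))) ⟩
      - (+ suc (toℕ i)) +ᶻ (+ toℕ (position (l i)) +ᶻ + suc (toℕ i)) ≡⟨ lemma (+ toℕ (position (l i))) (+ suc (toℕ i)) ⟩
      + toℕ (position (l i))                                       ∎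
      where
      lemma : ∀ x y → - y +ᶻ (x +ᶻ y) ≡ x
      lemma = solve-∀

  unit-edge : ∀ a → unitColour a ≡ colourOf (⟦ a ⟧ -ᶻ ⟦ v₀ ⟧)
  unit-edge a = trans (unit-congruent a≡b) (unit-base c)
    where
    c : Colour m
    c = colourOf (⟦ a ⟧ -ᶻ ⟦ v₀ ⟧)
    lemma : ∀ x y → x ≡ y +ᶻ (x -ᶻ y)
    lemma = solve-∀
    a≡b : ⟦ a ⟧ ≡ ⟦ v₀ ⊕ + toℕ (position c) ⟧ mod M
    a≡b = begin
      ⟦ a ⟧                              ≡⟨ lemma ⟦ a ⟧ ⟦ v₀ ⟧ ⟩
      ⟦ v₀ ⟧ +ᶻ (⟦ a ⟧ -ᶻ ⟦ v₀ ⟧)          ≈⟨ +-cong (≡-refl {x = ⟦ v₀ ⟧}) (position-colourOf (⟦ a ⟧ -ᶻ ⟦ v₀ ⟧)) ⟨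
      ⟦ v₀ ⟧ +ᶻ + toℕ (position c)        ≈⟨ mod-M (⊕-spec v₀ (+ toℕ (position c))) ⟨
      ⟦ v₀ ⊕ + toℕ (position c) ⟧         ∎
      where open ≡-mod-Reasoning M

  colourAt : Fin (suc n) → ℤ → Colour m
  colourAt a x = colourOf (⟦ a ⟧ -ᶻ ⟦ v₀ ⟧ +ᶻ x)

  colourAt-injective : ∀ a {x y} → colourAt a x ≡ colourAt a y → x ≡ y mod M
  colourAt-injective a e = +-cancelˡ {k = ⟦ a ⟧ -ᶻ ⟦ v₀ ⟧} (colourOf-injective e)

  -- The edge at offset x joins a to a + (2x + 1).
  span : ℤ → ℤ
  span x = x +ᶻ x +ᶻ + 1

  span-fwd : ∀ p → + (2 * p + 1) ≡ span (+ p)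
  span-fwd p = begin
      + (2 * p + 1)        ≡⟨ cong +_ (lemma p) ⟩
      + (p + p + 1)        ≡⟨ ℤ.pos-+ (p + p) 1 ⟩
      + (p + p) +ᶻ + 1     ≡⟨ cong (_+ᶻ + 1) (ℤ.pos-+ p p) ⟩
      span (+ p)           ∎
    where
    open ≡-Reasoning
    lemma : ∀ p → 2 * p + 1 ≡ p + p + 1
    lemma = ℕ-Solver.solve-∀

  span-bwd : ∀ p → - + (2 * p + 1) ≡ span -[1+ p ]
  span-bwd p = begin
      - + (2 * p + 1)                            ≡⟨ cong -_ (span-fwd p) ⟩
      - (+ p +ᶻ + p +ᶻ + 1)                      ≡⟨ lemma (+ p) ⟩
      span (- (+ 1 +ᶻ + p))                      ≡⟨ cong (span ∘ -_) (ℤ.pos-+ 1 p) ⟨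
      span -[1+ p ]                              ∎
    where
    open ≡-Reasoning
    lemma : ∀ x → - (x +ᶻ x +ᶻ + 1) ≡ - (+ 1 +ᶻ x) +ᶻ - (+ 1 +ᶻ x) +ᶻ + 1
    lemma = solve-∀

  forward-edge : ∀ a {p} → p ≤ m → φ a (a ⊕ + (2 * p + 1)) ≡ colourAt a (+ p)
  forward-edge a {p} p≤m = begin
      φ a (a ⊕ + (2 * p + 1))            ≡⟨ cong₂ φ (sym (⊕-cancel a (+ p))) ends ⟩
      φ (v ⊕ - (+ p)) (v ⊕ + (1 + p))    ≡⟨ rule-iv v p p≤m ⟩
      unitColour v                       ≡⟨ unit-edge v ⟩
      colourOf (⟦ v ⟧ -ᶻ ⟦ v₀ ⟧)          ≡⟨ colourOf-cong (mod-M centre) ⟩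
      colourAt a (+ p)                   ∎
    where
    open ≡-Reasoning
    v : Fin (suc n)
    v = a ⊕ + p
    lemma : ∀ p → 2 * p + 1 ≡ p + (1 + p)
    lemma = ℕ-Solver.solve-∀
    ends : a ⊕ + (2 * p + 1) ≡ v ⊕ + (1 + p)
    ends = sym (trans (⊕-assoc a (+ p) (+ (1 + p)))
                      (cong (a ⊕_) (trans (sym (ℤ.pos-+ p (1 + p))) (cong +_ (sym (lemma p))))))
    shuffle : ∀ x y z → x +ᶻ z -ᶻ y ≡ x -ᶻ y +ᶻ z
    shuffle = solve-∀
    centre : ⟦ v ⟧ -ᶻ ⟦ v₀ ⟧ ≡ ⟦ a ⟧ -ᶻ ⟦ v₀ ⟧ +ᶻ + p mod suc n
    centre = ≡-trans (+-cong (⊕-spec a (+ p)) (≡-refl {x = - ⟦ v₀ ⟧}))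
                     (≡-reflexive (shuffle ⟦ a ⟧ ⟦ v₀ ⟧ (+ p)))

  reverse-offset : ∀ a b p → a ≡ b ⊕ + (2 * p + 1) →
                   ⟦ b ⟧ -ᶻ ⟦ v₀ ⟧ +ᶻ + p ≡ ⟦ a ⟧ -ᶻ ⟦ v₀ ⟧ +ᶻ -[1+ p ] mod suc n
  reverse-offset a b p a≡b+ = begin
      ⟦ b ⟧ -ᶻ ⟦ v₀ ⟧ +ᶻ + p                                   ≡⟨ lemma ⟦ b ⟧ ⟦ v₀ ⟧ (+ p) ⟩
      ⟦ b ⟧ +ᶻ span (+ p) -ᶻ ⟦ v₀ ⟧ +ᶻ - (+ 1 +ᶻ + p)          ≡⟨ cong₂ (λ s t → ⟦ b ⟧ +ᶻ s -ᶻ ⟦ v₀ ⟧ +ᶻ t) (span-fwd p) (cong -_ (ℤ.pos-+ 1 p)) ⟨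
      ⟦ b ⟧ +ᶻ + (2 * p + 1) -ᶻ ⟦ v₀ ⟧ +ᶻ -[1+ p ]            ≈⟨ +-cong (+-cong (⊕-spec b (+ (2 * p + 1))) (≡-refl {x = - ⟦ v₀ ⟧})) (≡-refl {x = -[1+ p ]}) ⟨
      ⟦ b ⊕ + (2 * p + 1) ⟧ -ᶻ ⟦ v₀ ⟧ +ᶻ -[1+ p ]              ≡⟨ cong (λ c → ⟦ c ⟧ -ᶻ ⟦ v₀ ⟧ +ᶻ -[1+ p ]) a≡b+ ⟨
      ⟦ a ⟧ -ᶻ ⟦ v₀ ⟧ +ᶻ -[1+ p ]                              ∎
    where
    open ≡-mod-Reasoning (suc n)
    lemma : ∀ x y z → x -ᶻ y +ᶻ z ≡ x +ᶻ (z +ᶻ z +ᶻ + 1) -ᶻ y +ᶻ - (+ 1 +ᶻ z)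
    lemma = solve-∀

  backward-edge : ∀ a b {p} → p ≤ m → a ≡ b ⊕ + (2 * p + 1) → φ a b ≡ colourAt a -[1+ p ]
  backward-edge a b {p} p≤m a≡b+ = begin
      φ a b                       ≡⟨ symmetric a b (2 * p + 1 , (p , p≤m , refl) , inj₂ a≡b+) ⟩
      φ b a                       ≡⟨ cong (φ b) a≡b+ ⟩
      φ b (b ⊕ + (2 * p + 1))     ≡⟨ forward-edge b p≤m ⟩
      colourAt b (+ p)            ≡⟨ colourOf-cong (mod-M (reverse-offset a b p a≡b+)) ⟩
      colourAt a -[1+ p ]         ∎
    where open ≡-Reasoning

  edge-offset : ∀ a b → Adj a b → Σ ℤ λ x → Offset m x × b ≡ a ⊕ span x × φ a b ≡ colourAt a x
  edge-offset a b (_ , (p , p≤m , refl) , inj₁ b≡a+) =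
    + p , fwd p≤m , trans b≡a+ (cong (a ⊕_) (span-fwd p)) , trans (cong (φ a) b≡a+) (forward-edge a p≤m)
  edge-offset a b (_ , (p , p≤m , refl) , inj₂ a≡b+) =
    -[1+ p ] , bwd p≤m , b≡a- , backward-edge a b p≤m a≡b+
    where
    b≡a- : b ≡ a ⊕ span -[1+ p ]
    b≡a- = begin
      b                                        ≡⟨ ⊕-cancel b (+ (2 * p + 1)) ⟨
      (b ⊕ + (2 * p + 1)) ⊕ - + (2 * p + 1)    ≡⟨ cong₂ _⊕_ (sym a≡b+) (span-bwd p) ⟩
      a ⊕ span -[1+ p ]                        ∎
      where open ≡-Reasoning

  edge-at : ∀ a {x} → Offset m x → Σ (Fin (suc n)) λ b → Adj a b × φ a b ≡ colourAt a x
  edge-at a (fwd {p} p≤m) =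
    a ⊕ + (2 * p + 1) , (2 * p + 1 , (p , p≤m , refl) , inj₁ refl) , forward-edge a p≤m
  edge-at a (bwd {p} p≤m) =
    b , (2 * p + 1 , (p , p≤m , refl) , inj₂ a≡b+) , backward-edge a b p≤m a≡b+
    where
    b : Fin (suc n)
    b = a ⊕ - + (2 * p + 1)
    a≡b+ : a ≡ b ⊕ + (2 * p + 1)
    a≡b+ = sym (⊕-cancel′ a (+ (2 * p + 1)))

  -- φ is proper: the offset of an edge is determined by its colour, and the edge by its offset.
  proper : ∀ a b c → Adj a b → Adj a c → b ≢ c → φ a b ≢ φ a c
  proper a b c ab ac b≢c φab≡φac with edge-offset a b ab | edge-offset a c ac
  ... | x , o , b≡ , φab | y , o′ , c≡ , φac = b≢c (begin
      b              ≡⟨ b≡ ⟩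
      a ⊕ span x     ≡⟨ cong (λ z → a ⊕ span z) x≡y ⟩
      a ⊕ span y     ≡⟨ c≡ ⟨
      c              ∎)
    where
    open ≡-Reasoning
    x≡y : x ≡ y
    x≡y = offset-unique o o′ (colourAt-injective a (trans (sym φab) (trans φab≡φac φac)))

  all-colours : ∀ c → ∃[ a ] ∃[ b ] (Adj a b × φ a b ≡ c)
  all-colours c = a , a ⊕ + 1 , (1 , (0 , z≤n , refl) , inj₁ refl) , unit-base c
    where
    a : Fin (suc n)
    a = v₀ ⊕ + toℕ (position c)

  missing : ∀ a → ¬ (∃[ b ] (Adj a b × φ a b ≡ colourAt a (+ suc m)))
  missing a (b , ab , φab≡) with edge-offset a b ab
  ... | x , o , _ , φab = offset-misses o (colourAt-injective a (trans (sym φab) φab≡))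

  -- Conversely, if the colour missing at i is missing at j as well, then i ≡ j modulo M:
  -- otherwise it would have an offset from j, realised by an edge at j.
  same-missing : ∀ i j → ¬ (∃[ b ] (Adj j b × φ j b ≡ colourAt i (+ suc m))) → ⟦ i ⟧ ≡ ⟦ j ⟧ mod M
  same-missing i j missing-at-j = classify (offset-covers z)
    where
    -- z is the offset from j of the colour numbered i - v₀ + m + 1
    z : ℤ
    z = ⟦ i ⟧ -ᶻ ⟦ j ⟧ +ᶻ + suc m
    renumber : colourAt j z ≡ colourAt i (+ suc m)
    renumber = cong colourOf (lemma ⟦ i ⟧ ⟦ j ⟧ ⟦ v₀ ⟧ (+ suc m))
      where
      lemma : ∀ x y w k → y -ᶻ w +ᶻ (x -ᶻ y +ᶻ k) ≡ x -ᶻ w +ᶻ k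
      lemma = solve-∀
    classify : z ≡ + suc m mod M ⊎ Σ ℤ (λ x → Offset m x × x ≡ z mod M) → ⟦ i ⟧ ≡ ⟦ j ⟧ mod M
    classify (inj₁ z≡m+1) = begin
        ⟦ i ⟧                               ≡⟨ split ⟦ i ⟧ ⟦ j ⟧ (+ suc m) ⟩
        z +ᶻ (⟦ j ⟧ -ᶻ + suc m)              ≈⟨ +-cong z≡m+1 (≡-refl {x = ⟦ j ⟧ -ᶻ + suc m}) ⟩
        + suc m +ᶻ (⟦ j ⟧ -ᶻ + suc m)        ≡⟨ unsplit ⟦ j ⟧ (+ suc m) ⟩
        ⟦ j ⟧                               ∎
      where
      open ≡-mod-Reasoning M
      split : ∀ x y k → x ≡ x -ᶻ y +ᶻ k +ᶻ (y -ᶻ k)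
      split = solve-∀
      unsplit : ∀ y k → k +ᶻ (y -ᶻ k) ≡ y
      unsplit = solve-∀
    classify (inj₂ (x , o , x≡z)) with edge-at j o
    ... | b , jb , φjb = ⊥-elim (missing-at-j (b , jb , trans φjb (trans (colourOf-cong x≈z) renumber)))
      where
      x≈z : ⟦ j ⟧ -ᶻ ⟦ v₀ ⟧ +ᶻ x ≡ ⟦ j ⟧ -ᶻ ⟦ v₀ ⟧ +ᶻ z mod M
      x≈z = +-cong (≡-refl {x = ⟦ j ⟧ -ᶻ ⟦ v₀ ⟧}) x≡z

  -- Vertices with the same colour set miss the same colour, so they are congruent modulo M,
  -- which is impossible at distance 1, …, 2m + 2.
  distinct : ∀ i j → 1 ≤ dist i j → dist i j ≤ 2 * m + 2 →
             ¬ (∀ (c : Colour m) → (∃[ b ] (Adj i b × φ i b ≡ c)) ⇔ (∃[ b ] (Adj j b × φ j b ≡ c)))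
  distinct i j 1≤d d≤2m+2 same-colours =
    near-incongruent M∣N i j 1≤d d<M
      (same-missing i j (missing i ∘ Equivalence.from (same-colours (colourAt i (+ suc m)))))
    where
    2m+2≡ : ∀ m → 2 * m + 2 ≡ suc m + suc m
    2m+2≡ = ℕ-Solver.solve-∀
    d<M : dist i j < M
    d<M = s≤s (subst (dist i j ≤_) (2m+2≡ m) d≤2m+2)

-- The theorem: N = (2m + 3)k is nonzero (only k ≠ 0 is used) and divisible by M, so the module
-- Colouring applies.
lemma2 : (m k : ℕ) → 2 ≤ k →
    let n = (2 * m + 3) * k
        Adj : Fin n → Fin n → Set
        Adj = CircAdj (U m)
    in (v₀ : Fin n) → (φ : Fin n → Fin n → Colour m) →
    -- φ is an edge colouring: its value on an edge does not depend on orientation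
    (∀ a b → Adj a b → φ a b ≡ φ b a) →
    -- rule (i)
    φ v₀ (v₀ ⊕ + 1) ≡ c0 →
    -- rule (ii)
    (∀ (i : Fin (suc m)) → φ (v₀ ⊕ + (1 + toℕ i)) (v₀ ⊕ + (2 + toℕ i)) ≡ r i) →
    (∀ (i : Fin (suc m)) → φ (v₀ ⊕ -[1+ toℕ i ]) (v₀ ⊕ - (+ toℕ i)) ≡ l i) →
    -- rule (iii)
    (∀ v → φ (v ⊕ + (2 * m + 3)) (v ⊕ + (2 * m + 4)) ≡ φ v (v ⊕ + 1)) →
    -- rule (iv)
    (∀ v p → p ≤ m → φ (v ⊕ - (+ p)) (v ⊕ + (1 + p)) ≡ φ v (v ⊕ + 1)) →
    -- proper edge colouring
    ((∀ a b c → Adj a b → Adj a c → b ≢ c → φ a b ≢ φ a c)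
    -- all 2m+3 colours are used
    × (∀ (c : Colour m) → ∃[ a ] ∃[ b ] (Adj a b × φ a b ≡ c))
    -- vertices at distance 1..2m+2 have distinct incident colour sets
    × (∀ i j → 1 ≤ dist i j → dist i j ≤ 2 * m + 2 →
         ¬ (∀ (c : Colour m) →
              (∃[ b ] (Adj i b × φ i b ≡ c)) ⇔ (∃[ b ] (Adj j b × φ j b ≡ c)))))
lemma2 m k 2≤k with (2 * m + 3) * k in N≡
... | zero  = ⊥-elim ([ ℕ.m+1+n≢0 (2 * m) , k≢0 ]′ (ℕ.m*n≡0⇒m≡0∨n≡0 (2 * m + 3) N≡))
  where
  k≢0 : k ≢ 0
  k≢0 k≡0 = ℕ.<⇒≢ (ℕ.≤-trans (s≤s z≤n) 2≤k) (sym k≡0)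
... | suc n = λ v₀ φ symmetric rule-i rule-ii-r rule-ii-l rule-iii rule-iv →
  let open Colouring M∣N v₀ φ symmetric rule-i rule-ii-r rule-ii-l rule-iii rule-iv
  in proper , all-colours , distinct
  where
  M∣N : period m ℕ∣.∣ suc n
  M∣N = ℕ∣.divides k (begin
    suc n               ≡⟨ N≡ ⟨
    (2 * m + 3) * k     ≡⟨ cong (_* k) (period≡ m) ⟩
    period m * k        ≡⟨ ℕ.*-comm (period m) k ⟩
    k * period m        ∎)
    where open ≡-Reasoning
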